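{- For all integers $m,n\ge 2$, $R_{\pi}(K_{1,n},K_m)=n$.
   Context: All graphs are finite and simple. For graphs $F,G,H$, write $F\rightarrow(G,H)$ if every red-blue coloring of the edges of $F$ contains a red copy of $G$ or a blue copy of $H$. The Ramsey number $R(G,H)$ is the smallest $r$ with $K_r\rightarrow(G,H)$. $K_r\setminus P_k$ denotes $K_r$ with the edges of a path on $k$ vertices ($k\le r$) deleted. The path-critical Ramsey number is $R_{\pi}(G,H)=\max\{k: K_r\setminus P_k\rightarrow(G,H)\}$ where $r=R(G,H)$. $K_{1,n}$ is the star with $n$ leaves. -}

module Defs where

open import Data.Nat using (ℕ; zero; suc; _<_; _≤_)
open import Data.Fin using (Fin; toℕ) renaming (zero to fzero)
open import Data.Product using (Σ; _×_; _,_)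
open import Data.Sum using (_⊎_)
open import Relation.Binary.PropositionalEquality using (_≡_; _≢_)
open import Relation.Nullary using (¬_)
open import Function.Definitions using (Injective)

record Graph : Set₁ where
  field
    V     : ℕ
    E     : Fin V → Fin V → Set
    sym   : ∀ {u v} → E u v → E v u
    irrefl : ∀ {u} → ¬ E u u
open Graph public

data Colour : Set where
  red blue : Colour

-- A red/blue colouring of the edges of F: one colour per unordered pair
-- (values on non-edges are irrelevant).
record Colouring (F : Graph) : Set where
  field
    col  : Fin (V F) → Fin (V F) → Colour
    csym : ∀ u v → col u v ≡ col v u
open Colouring public

MonoCopy : (F : Graph) → Colouring F → Colour → (G : Graph) → Set
MonoCopy F χ c G =
  Σ (Fin (V G) → Fin (V F)) λ f →
    Injective _≡_ _≡_ f ×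
    (∀ u v → E G u v → E F (f u) (f v) × col χ (f u) (f v) ≡ c)

Arrows : Graph → Graph → Graph → Set
Arrows F G H = (χ : Colouring F) → MonoCopy F χ red G ⊎ MonoCopy F χ blue H

K : ℕ → Graph
K r = record { V = r ; E = λ u v → u ≢ v ; sym = λ p q → p (Relation.Binary.PropositionalEquality.sym q) ; irrefl = λ p → p Relation.Binary.PropositionalEquality.refl }

Star : ℕ → Graph
Star n = record
  { V = suc n
  ; E = λ u v → (u ≡ fzero × v ≢ fzero) ⊎ (v ≡ fzero × u ≢ fzero)
  ; sym = λ { (Data.Sum.inj₁ p) → Data.Sum.inj₂ p ; (Data.Sum.inj₂ p) → Data.Sum.inj₁ p }
  ; irrefl = λ { (Data.Sum.inj₁ (p , q)) → q p ; (Data.Sum.inj₂ (p , q)) → q p }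
  }

-- Edge {u,v} of the path on the first k vertices 0 - 1 - ... - (k-1)
PathEdge : ∀ {r} → ℕ → Fin r → Fin r → Set
PathEdge k u v = (suc (toℕ u) ≡ toℕ v × toℕ v < k) ⊎ (suc (toℕ v) ≡ toℕ u × toℕ u < k)

KminusP : (r k : ℕ) → Graph
KminusP r k = record
  { V = r
  ; E = λ u v → u ≢ v × ¬ PathEdge k u v
  ; sym = λ { (p , q) → (λ e → p (Relation.Binary.PropositionalEquality.sym e))
                     , (λ { (Data.Sum.inj₁ x) → q (Data.Sum.inj₂ x) ; (Data.Sum.inj₂ x) → q (Data.Sum.inj₁ x) }) }
  ; irrefl = λ { (p , _) → p Relation.Binary.PropositionalEquality.refl }
  }

IsRamseyNumber : Graph → Graph → ℕ → Set
IsRamseyNumber G H r = Arrows (K r) G H × (∀ s → Arrows (K s) G H → r ≤ s)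

IsPathCriticalRamsey : Graph → Graph → ℕ → Set
IsPathCriticalRamsey G H k =
  Σ ℕ λ r → IsRamseyNumber G H r ×
    (k ≤ r × Arrows (KminusP r k) G H) ×
    (∀ k′ → k′ ≤ r → Arrows (KminusP r k′) G H → k′ ≤ k)

-- Upper bound: list the vertices in decreasing order and build a blue clique greedily from the
-- front. In K_r \ P_n every vertex of index ≥ n is adjacent to all others, so a head with n red
-- neighbours among the later vertices is the centre of a red K_{1,n}; otherwise all but at most
-- n-1 of them are blue neighbours and we recurse on those. Thus (m-1)n+1 vertices force a red
-- K_{1,n} or a blue K_m, already in K_r \ P_n ⊆ K_r.
-- Lower bounds: colour an edge red iff both ends lie in the same block of an ordered partition
-- into m-1 blocks, so there is no blue K_m. Blocks of n vertices make K_{(m-1)n} red-star-free.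
-- In K_r \ P_{n+1}, put the path vertices 0,…,n into the first block: each of them misses its path
-- neighbour, so again no vertex has n red neighbours.
module Submission where

open import Defs
open import Data.Bool.Base using (true; false)
open import Data.Nat.Base
  using (ℕ; zero; suc; pred; _+_; _*_; _∸_; _≤_; _<_; z≤n; s≤s; s≤s⁻¹; NonZero; >-nonZero⁻¹)
open import Data.Nat.Properties as ℕ
  using (≤-refl; ≤-trans; ≤-reflexive; <-≤-trans; _≤?_; _<?_; ≮⇒≥; 1+n≰n; <⇒≢; <⇒≱)
open import Data.Nat.DivMod using (_/_; _%_; m≡m%n+[m/n]*n; m%n<n; m<n*o⇒m/o<n; m/n≡0⇒m<n; m<n⇒m/n≡0)
open import Data.Fin.Base using (Fin; toℕ; inject≤; opposite) renaming (zero to fzero; suc to fsuc)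
open import Data.Fin.Properties as Finₚ
  using (toℕ<n; toℕ-injective; fromℕ<-injective; inject≤-injective; injective⇒≤; opposite-prop)
open import Data.Vec.Functional using () renaming (_∷_ to _◃_)
open import Data.List.Base using (List; []; _∷_; length; lookup; filter; tabulate)
open import Data.List.Properties using (length-tabulate)
open import Data.List.Membership.Propositional using (_∈_)
open import Data.List.Membership.Propositional.Properties using (∈-filter⁻; ∈-lookup)
open import Data.List.Relation.Unary.All as All using (_∷_)
open import Data.List.Relation.Unary.Any using (here; there)
open import Data.List.Relation.Unary.AllPairs as AllPairs using (AllPairs; _∷_)
open import Data.List.Relation.Unary.AllPairs.Properties using (tabulate⁺-<; filter⁺)
open import Data.List.Relation.Unary.Unique.Propositional using (Unique)
open import Data.Product using (Σ; _×_; _,_; proj₁; proj₂)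
import Data.Product as Product
open import Data.Sum using (_⊎_; inj₁; inj₂)
import Data.Sum as Sum
open import Data.Empty using (⊥; ⊥-elim)
open import Function using (_∘_; id; flip)
open import Function.Definitions using (Injective)
open import Relation.Nullary using (¬_; Dec; does; yes; no; contradiction)
open import Relation.Nullary.Decidable using (decidable-stable)
open import Relation.Unary using (Pred; Decidable)
open import Relation.Unary.Properties using (∁?)
open import Relation.Binary.PropositionalEquality as ≡ using (_≡_; _≢_; refl; cong; cong₂; trans; subst)

bounded-injective⇒≤ : ∀ {k b} {a : Fin k → ℕ} → Injective _≡_ _≡_ a → (∀ x → a x < b) → k ≤ b
bounded-injective⇒≤ {a = a} a-inj a<b =
  injective⇒≤ (λ {x} {y} eq → a-inj (fromℕ<-injective (a x) (a y) (a<b x) (a<b y) eq))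

-- On a fibre of _/ n, a number is determined by its remainder.
same-quotient-injective⇒≤ : ∀ {k n q} .{{_ : NonZero n}} {a : Fin k → ℕ} →
                            Injective _≡_ _≡_ a → (∀ x → a x / n ≡ q) → k ≤ n
same-quotient-injective⇒≤ {n = n} {a = a} a-inj a/n≡q =
  bounded-injective⇒≤ (λ {x} {y} eq → a-inj (begin
    a x                   ≡⟨ m≡m%n+[m/n]*n (a x) n ⟩
    a x % n + a x / n * n ≡⟨ cong₂ (λ r d → r + d * n) eq (trans (a/n≡q x) (≡.sym (a/n≡q y))) ⟩
    a y % n + a y / n * n ≡⟨ m≡m%n+[m/n]*n (a y) n ⟨
    a y                   ∎))
    (λ x → m%n<n (a x) n)
  where open ≡.≡-Reasoning

injective-◃ : ∀ {A : Set} {k} {x : A} {g : Fin k → A} →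
              Injective _≡_ _≡_ g → (∀ i → g i ≢ x) → Injective _≡_ _≡_ (x ◃ g)
injective-◃ g-inj g≢x {fzero}  {fzero}  _  = refl
injective-◃ g-inj g≢x {fzero}  {fsuc j} eq = contradiction (≡.sym eq) (g≢x j)
injective-◃ g-inj g≢x {fsuc i} {fzero}  eq = contradiction eq (g≢x i)
injective-◃ g-inj g≢x {fsuc i} {fsuc j} eq = cong fsuc (g-inj eq)

lookup-injective : ∀ {A : Set} {xs : List A} → Unique xs → Injective _≡_ _≡_ (lookup xs)
lookup-injective (x∉xs ∷ _)  {fzero}  {fzero}  _  = refl
lookup-injective (x∉xs ∷ _)  {fzero}  {fsuc j} eq = contradiction eq (All.lookup x∉xs (∈-lookup j))
lookup-injective (x∉xs ∷ _)  {fsuc i} {fzero}  eq = contradiction (≡.sym eq) (All.lookup x∉xs (∈-lookup i))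
lookup-injective (_ ∷ xs!) {fsuc i} {fsuc j} eq = cong fsuc (lookup-injective xs! eq)

length-filter-∁ : ∀ {a p} {A : Set a} {P : Pred A p} (P? : Decidable P) xs →
                  length (filter P? xs) + length (filter (∁? P?) xs) ≡ length xs
length-filter-∁ P? [] = refl
length-filter-∁ P? (x ∷ xs) with does (P? x)
... | true  = cong suc (length-filter-∁ P? xs)
... | false = trans (ℕ.+-suc _ _) (cong suc (length-filter-∁ P? xs))

Embedding : Graph → Graph → Set
Embedding F F′ = Σ (Fin (V F) → Fin (V F′)) λ h →
  Injective _≡_ _≡_ h × (∀ u v → E F u v → E F′ (h u) (h v))

Arrows-mono : ∀ {F F′ G H} → Embedding F F′ → Arrows F G H → Arrows F′ G H
Arrows-mono {F} {F′} {G} {H} (h , h-inj , h-edge) arrow χ′ =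
  Sum.map (push {red} {G}) (push {blue} {H}) (arrow pullback)
  where
  pullback : Colouring F
  pullback = record { col = λ u v → col χ′ (h u) (h v) ; csym = λ u v → csym χ′ (h u) (h v) }
  push : ∀ {c J} → MonoCopy F pullback c J → MonoCopy F′ χ′ c J
  push (g , g-inj , g-edge) = h ∘ g , g-inj ∘ h-inj , λ u v → Product.map₁ (h-edge (g u) (g v)) ∘ g-edge u v

PathEdge-mono : ∀ {r k k′} {u v : Fin r} → k ≤ k′ → PathEdge k u v → PathEdge k′ u v
PathEdge-mono k≤k′ (inj₁ (1+u≡v , v<k)) = inj₁ (1+u≡v , <-≤-trans v<k k≤k′)
PathEdge-mono k≤k′ (inj₂ (1+v≡u , u<k)) = inj₂ (1+v≡u , <-≤-trans u<k k≤k′)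

KminusP⊆K : ∀ {r k} → Embedding (KminusP r k) (K r)
KminusP⊆K = id , id , λ _ _ → proj₁

KminusP-antitone : ∀ {r k k′} → k ≤ k′ → Embedding (KminusP r k′) (KminusP r k)
KminusP-antitone k≤k′ = id , id , λ _ _ → Product.map₂ (λ ¬path → ¬path ∘ PathEdge-mono k≤k′)

centre-leaf : ∀ {n} (i : Fin n) → E (Star n) fzero (fsuc i)
centre-leaf i = inj₁ (refl , λ ())

edge⇒≢ : ∀ (F : Graph) {u v} → E F u v → v ≢ u
edge⇒≢ F e refl = irrefl F e

module _ {F : Graph} (χ : Colouring F) where

  ColouredEdge : Colour → Fin (V F) → Fin (V F) → Set
  ColouredEdge c u v = E F u v × col χ u v ≡ c

  ColouredEdge-sym : ∀ {c u v} → ColouredEdge c u v → ColouredEdge c v u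
  ColouredEdge-sym {u = u} {v} (e , eq) = Graph.sym F e , trans (csym χ v u) eq

  star-cone : ∀ {c n} v (ℓ : Fin n → Fin (V F)) → Injective _≡_ _≡_ ℓ →
              (∀ i → ColouredEdge c v (ℓ i)) → MonoCopy F χ c (Star n)
  star-cone {c} {n} v ℓ ℓ-inj v─ℓ = v ◃ ℓ , injective-◃ ℓ-inj (edge⇒≢ F ∘ proj₁ ∘ v─ℓ) , edge
    where
    edge : ∀ a b → E (Star n) a b → ColouredEdge c ((v ◃ ℓ) a) ((v ◃ ℓ) b)
    edge fzero    fzero    e = ⊥-elim (irrefl (Star n) e)
    edge fzero    (fsuc i) _ = v─ℓ i
    edge (fsuc i) fzero    _ = ColouredEdge-sym (v─ℓ i)
    edge (fsuc _) (fsuc _) (inj₁ (() , _))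
    edge (fsuc _) (fsuc _) (inj₂ (() , _))

  clique-cone : ∀ {c k} v ((g , _) : MonoCopy F χ c (K k)) →
                (∀ a → ColouredEdge c v (g a)) → MonoCopy F χ c (K (suc k))
  clique-cone {c} {k} v (g , g-inj , g-edge) v─g = v ◃ g , injective-◃ g-inj (edge⇒≢ F ∘ proj₁ ∘ v─g) , edge
    where
    edge : ∀ a b → a ≢ b → ColouredEdge c ((v ◃ g) a) ((v ◃ g) b)
    edge fzero    fzero    0≢0 = contradiction refl 0≢0
    edge fzero    (fsuc b) _   = v─g b
    edge (fsuc a) fzero    _   = ColouredEdge-sym (v─g a)
    edge (fsuc a) (fsuc b) a≢b = g-edge a b (a≢b ∘ cong fsuc)

  empty-clique : ∀ {c} → MonoCopy F χ c (K 0)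
  empty-clique = (λ ()) , (λ { {()} }) , (λ ())

red? : (c : Colour) → Dec (c ≡ red)
red? red  = yes refl
red? blue = no λ ()

¬red⇒blue : ∀ {c} → c ≢ red → c ≡ blue
¬red⇒blue {red}  c≢red = contradiction refl c≢red
¬red⇒blue {blue} _     = refl

UniversalFrom : ℕ → Graph → Set
UniversalFrom n F = ∀ {v u} → n ≤ toℕ v → v ≢ u → E F v u

module Greedy (F : Graph) (n : ℕ) (universal : UniversalFrom n F) (χ : Colouring F) where

  Descending : List (Fin (V F)) → Set
  Descending = AllPairs (λ v u → toℕ u < toℕ v)

  Descending⇒Unique : ∀ {xs} → Descending xs → Unique xs
  Descending⇒Unique = AllPairs.map (λ u<v v≡u → <⇒≢ u<v (cong toℕ (≡.sym v≡u)))

  length≤head : ∀ {v xs} → Descending (v ∷ xs) → length xs ≤ toℕ v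
  length≤head {xs = []}    _                   = z≤n
  length≤head {xs = _ ∷ _} ((u<v ∷ _) ∷ desc) = ≤-trans (s≤s (length≤head desc)) u<v

  head-universal : ∀ {v xs} → Descending (v ∷ xs) → n ≤ length xs → ∀ {u} → u ∈ xs → E F v u
  head-universal desc@(v>xs ∷ _) n≤xs u∈xs =
    universal (≤-trans n≤xs (length≤head desc)) (λ { refl → 1+n≰n (All.lookup v>xs u∈xs) })

  reds blues : Fin (V F) → List (Fin (V F)) → List (Fin (V F))
  reds  v = filter (λ u → red? (col χ v u))
  blues v = filter (∁? (λ u → red? (col χ v u)))

  BlueCliqueIn : List (Fin (V F)) → ℕ → Set
  BlueCliqueIn xs k = Σ (MonoCopy F χ blue (K k)) λ (g , _) → ∀ a → g a ∈ xs

  red-star : ∀ {v xs} → (∀ {u} → u ∈ xs → E F v u) → Descending xs →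
             n ≤ length (reds v xs) → MonoCopy F χ red (Star n)
  red-star {v} {xs} v─xs desc n≤reds = star-cone χ v leaf leaf-injective leaf-edge
    where
    leaf : Fin n → Fin (V F)
    leaf i = lookup (reds v xs) (inject≤ i n≤reds)
    leaf-injective : Injective _≡_ _≡_ leaf
    leaf-injective {i} {j} = inject≤-injective _ _ i j
                           ∘ lookup-injective (Descending⇒Unique (filter⁺ _ desc))
    leaf-edge : ∀ i → ColouredEdge χ red v (leaf i)
    leaf-edge i = Product.map₁ v─xs (∈-filter⁻ _ (∈-lookup (inject≤ i n≤reds)))

  blue-cone : ∀ {v xs k} → (∀ {u} → u ∈ xs → E F v u) →
              BlueCliqueIn (blues v xs) k → BlueCliqueIn (v ∷ xs) (suc k)
  blue-cone {v} {xs} v─xs (clique@(g , _) , ∈blues) = clique-cone χ v clique blue-edge , member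
    where
    blue-edge : ∀ a → ColouredEdge χ blue v (g a)
    blue-edge a = Product.map v─xs ¬red⇒blue (∈-filter⁻ _ (∈blues a))
    member : ∀ a → (v ◃ g) a ∈ v ∷ xs
    member fzero    = here refl
    member (fsuc a) = there (proj₁ (∈-filter⁻ _ (∈blues a)))

  many-blues : ∀ {v xs j} → ¬ n ≤ length (reds v xs) → n + j * n ≤ length xs →
               j * n < length (blues v xs)
  many-blues {v} {xs} {j} n≰reds n+jn≤xs = ℕ.+-cancelˡ-≤ (length (reds v xs)) _ _ (begin
    length (reds v xs) + suc (j * n)          ≡⟨ ℕ.+-suc _ (j * n) ⟩
    suc (length (reds v xs)) + j * n          ≤⟨ ℕ.+-monoˡ-≤ (j * n) (ℕ.≰⇒> n≰reds) ⟩
    n + j * n                                 ≤⟨ n+jn≤xs ⟩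
    length xs                                 ≡⟨ length-filter-∁ _ xs ⟨
    length (reds v xs) + length (blues v xs)  ∎)
    where open ℕ.≤-Reasoning

  star-or-clique : ∀ j xs → Descending xs → j * n < length xs →
                   MonoCopy F χ red (Star n) ⊎ BlueCliqueIn xs (suc j)
  star-or-clique zero (v ∷ _) _ _ =
    inj₂ (clique-cone χ v (empty-clique χ) (λ ()) , λ { fzero → here refl })
  star-or-clique (suc j) (v ∷ xs) desc@(_ ∷ xs↓) [1+j]n<1+xs
    with v─xs ← head-universal desc (≤-trans (ℕ.m≤m+n n (j * n)) (s≤s⁻¹ [1+j]n<1+xs))
       | n ≤? length (reds v xs)
  ... | yes n≤reds = inj₁ (red-star v─xs xs↓ n≤reds)
  ... | no  n≰reds = Sum.map₂ (blue-cone v─xs) (star-or-clique j (blues v xs) (filter⁺ _ xs↓)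
                       (many-blues {v} {xs} {j} n≰reds (s≤s⁻¹ [1+j]n<1+xs)))

  vertices : List (Fin (V F))
  vertices = tabulate opposite

  vertices-descending : Descending vertices
  vertices-descending = tabulate⁺-< λ {i} {j} i<j → begin-strict
    toℕ (opposite j)   ≡⟨ opposite-prop j ⟩
    V F ∸ suc (toℕ j) <⟨ ℕ.∸-monoʳ-< (s≤s i<j) (toℕ<n j) ⟩
    V F ∸ suc (toℕ i) ≡⟨ opposite-prop i ⟨
    toℕ (opposite i)   ∎
    where open ℕ.≤-Reasoning

universal⇒arrows : ∀ {F n} j → UniversalFrom n F → j * n < V F → Arrows F (Star n) (K (suc j))
universal⇒arrows {F} {n} j universal jn<V χ = Sum.map₂ proj₁
  (star-or-clique j vertices vertices-descending (subst (j * n <_) (≡.sym (length-tabulate opposite)) jn<V))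
  where open Greedy F n universal χ

colourOf : ∀ {P : Set} → Dec P → Colour
colourOf (yes _) = red
colourOf (no _)  = blue

colourOf-red⇒ : ∀ {P : Set} (P? : Dec P) → colourOf P? ≡ red → P
colourOf-red⇒ (yes p) _ = p

colourOf-blue⇒ : ∀ {P : Set} (P? : Dec P) → colourOf P? ≡ blue → ¬ P
colourOf-blue⇒ (no ¬p) _ = ¬p

colourOf-cong : ∀ {P Q : Set} → (P → Q) → (Q → P) → (P? : Dec P) (Q? : Dec Q) → colourOf P? ≡ colourOf Q?
colourOf-cong P→Q Q→P (yes _) (yes _) = refl
colourOf-cong P→Q Q→P (no _)  (no _)  = refl
colourOf-cong P→Q Q→P (yes p) (no ¬q) = contradiction (P→Q p) ¬q
colourOf-cong P→Q Q→P (no ¬p) (yes q) = contradiction (Q→P q) ¬p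

module _ (F : Graph) (block : Fin (V F) → ℕ) where

  blockColouring : Colouring F
  blockColouring = record
    { col  = λ u v → colourOf (block u ℕ.≟ block v)
    ; csym = λ u v → colourOf-cong ≡.sym ≡.sym (block u ℕ.≟ block v) (block v ℕ.≟ block u)
    }

  red-star⇒one-block : ∀ {n} ((f , _) : MonoCopy F blockColouring red (Star n)) →
                       ∀ x → block (f x) ≡ block (f fzero)
  red-star⇒one-block _                 fzero    = refl
  red-star⇒one-block (f , _ , f-edge) (fsuc i) =
    ≡.sym (colourOf-red⇒ (block (f fzero) ℕ.≟ block (f (fsuc i)))
                         (proj₂ (f-edge fzero (fsuc i) (centre-leaf i))))

  blue-clique≤blocks : ∀ {k M} → (∀ u → block u < M) → MonoCopy F blockColouring blue (K k) → k ≤ M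
  blue-clique≤blocks block<M (g , _ , g-edge) = bounded-injective⇒≤ blocks-differ (block<M ∘ g)
    where
    blocks-differ : Injective _≡_ _≡_ (block ∘ g)
    blocks-differ {a} {b} eq = decidable-stable (a Finₚ.≟ b)
      (λ a≢b → colourOf-blue⇒ (block (g a) ℕ.≟ block (g b)) (proj₂ (g-edge a b a≢b)) eq)

K-non-arrow : ∀ n M s .{{_ : NonZero n}} → s ≤ M * n → ¬ Arrows (K s) (Star n) (K (suc M))
K-non-arrow n M s s≤Mn arrow = Sum.[ no-red-star , no-blue-clique ] (arrow χ)
  where
  quotient : Fin s → ℕ
  quotient u = toℕ u / n
  χ : Colouring (K s)
  χ = blockColouring (K s) quotient
  no-red-star : ¬ MonoCopy (K s) χ red (Star n)
  no-red-star star@(f , f-inj , _) =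
    1+n≰n (same-quotient-injective⇒≤ (f-inj ∘ toℕ-injective) (red-star⇒one-block (K s) quotient star))
  no-blue-clique : ¬ MonoCopy (K s) χ blue (K (suc M))
  no-blue-clique = 1+n≰n ∘ blue-clique≤blocks (K s) quotient (λ u → m<n*o⇒m/o<n (<-≤-trans (toℕ<n u) s≤Mn))

record PathNeighbour (n : ℕ) {r} (c : Fin r) : Set where
  field
    neighbour          : ℕ
    neighbour≤n        : neighbour ≤ n
    neighbour≢centre   : neighbour ≢ toℕ c
    joined-on-the-path : ∀ u → toℕ u ≡ neighbour → PathEdge (suc n) c u

path-neighbour : ∀ {r n} .{{_ : NonZero n}} (c : Fin r) → toℕ c ≤ n → PathNeighbour n c
path-neighbour {n = n} c c≤n with toℕ c <? n
... | yes c<n = record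
  { neighbour          = suc (toℕ c)
  ; neighbour≤n        = c<n
  ; neighbour≢centre   = ℕ.1+n≢n
  ; joined-on-the-path = λ u u≡1+c → inj₁ (≡.sym u≡1+c , s≤s (≤-trans (≤-reflexive u≡1+c) c<n))
  }
path-neighbour {n = suc n′} c c≤n | no c≮n = record
  { neighbour          = n′
  ; neighbour≤n        = ℕ.n≤1+n n′
  ; neighbour≢centre   = ℕ.1+n≢n ∘ ≡.sym ∘ flip trans c≡n
  ; joined-on-the-path = λ u u≡n′ → inj₂ (trans (cong suc u≡n′) (≡.sym c≡n) , s≤s c≤n)
  }
  where
  c≡n : toℕ c ≡ suc n′
  c≡n = ℕ.≤-antisym c≤n (≮⇒≥ c≮n)

module _ (n M : ℕ) .{{_ : NonZero n}} .{{_ : NonZero M}} where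

  private
    F : Graph
    F = KminusP (suc (M * n)) (suc n)

  -- Vertex 0 joins the first block, which is thus the vertex set {0, …, n} of the deleted path.
  pathBlock : Fin (suc (M * n)) → ℕ
  pathBlock fzero    = 0
  pathBlock (fsuc u) = toℕ u / n

  pathBlock<M : ∀ u → pathBlock u < M
  pathBlock<M fzero    = >-nonZero⁻¹ M
  pathBlock<M (fsuc u) = m<n*o⇒m/o<n (toℕ<n u)

  pathBlock≡0⇒≤n : ∀ {u} → pathBlock u ≡ 0 → toℕ u ≤ n
  pathBlock≡0⇒≤n {fzero}  _   = z≤n
  pathBlock≡0⇒≤n {fsuc u} u≡0 = m/n≡0⇒m<n u≡0

  ≤n⇒pathBlock≡0 : ∀ {u} → toℕ u ≤ n → pathBlock u ≡ 0
  ≤n⇒pathBlock≡0 {fzero}  _   = refl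
  ≤n⇒pathBlock≡0 {fsuc u} u<n = m<n⇒m/n≡0 u<n

  pathBlock≢0⇒ : ∀ {u} → pathBlock u ≢ 0 → 1 ≤ toℕ u × pred (toℕ u) / n ≡ pathBlock u
  pathBlock≢0⇒ {fzero}  0≢0 = contradiction refl 0≢0
  pathBlock≢0⇒ {fsuc u} _   = s≤s z≤n , refl

  private
    χ : Colouring F
    χ = blockColouring F pathBlock

  module _ (star : MonoCopy F χ red (Star n)) where

    private
      f : Fin (suc n) → Fin (suc (M * n))
      f = proj₁ star
      f-inj : Injective _≡_ _≡_ f
      f-inj = proj₁ (proj₂ star)
      c : Fin (suc (M * n))
      c = f fzero
      one-block : ∀ x → pathBlock (f x) ≡ pathBlock c
      one-block = red-star⇒one-block F pathBlock star

    -- The path neighbour of the centre lies in the first block but is not joined to the centre.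
    no-star-in-first-block : toℕ c ≤ n → ⊥
    no-star-in-first-block c≤n =
      1+n≰n (bounded-injective⇒≤ (injective-◃ (f-inj ∘ toℕ-injective) f≢neighbour) ≤n)
      where
      open PathNeighbour (path-neighbour c c≤n)
      f≢neighbour : ∀ x → toℕ (f x) ≢ neighbour
      f≢neighbour fzero    = neighbour≢centre ∘ ≡.sym
      f≢neighbour (fsuc i) = proj₂ (proj₁ (proj₂ (proj₂ star) fzero (fsuc i) (centre-leaf i)))
                           ∘ joined-on-the-path (f (fsuc i))
      ≤n : ∀ x → (neighbour ◃ (toℕ ∘ f)) x < suc n
      ≤n fzero    = s≤s neighbour≤n
      ≤n (fsuc x) = s≤s (pathBlock≡0⇒≤n (trans (one-block x) (≤n⇒pathBlock≡0 c≤n)))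

    no-star-in-later-block : n < toℕ c → ⊥
    no-star-in-later-block n<c = 1+n≰n (same-quotient-injective⇒≤ pred-injective (proj₂ ∘ shifted))
      where
      shifted : ∀ x → 1 ≤ toℕ (f x) × pred (toℕ (f x)) / n ≡ pathBlock c
      shifted x = Product.map₂ (flip trans (one-block x)) (pathBlock≢0⇒ λ fx≡0 →
                    ℕ.<⇒≱ n<c (pathBlock≡0⇒≤n (trans (≡.sym (one-block x)) fx≡0)))
      pred-injective : Injective _≡_ _≡_ (pred ∘ toℕ ∘ f)
      pred-injective {x} {y} = f-inj ∘ toℕ-injective ∘ ℕ.∸-cancelʳ-≡ (proj₁ (shifted x)) (proj₁ (shifted y))

  KminusP-non-arrow : ¬ Arrows F (Star n) (K (suc M))
  KminusP-non-arrow arrow = Sum.[ no-red-star , no-blue-clique ] (arrow χ)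
    where
    no-red-star : ¬ MonoCopy F χ red (Star n)
    no-red-star star = Sum.[ no-star-in-first-block star , no-star-in-later-block star ]
                         (ℕ.≤-<-connex (toℕ (proj₁ star fzero)) n)
    no-blue-clique : ¬ MonoCopy F χ blue (K (suc M))
    no-blue-clique = 1+n≰n ∘ blue-clique≤blocks F pathBlock pathBlock<M

KminusP-universal : ∀ {r n} → UniversalFrom n (KminusP r n)
KminusP-universal n≤v v≢u = v≢u , λ
  { (inj₁ (1+v≡u , u<n)) → <⇒≱ (<-≤-trans (≤-reflexive 1+v≡u) (ℕ.<⇒≤ u<n)) n≤v
  ; (inj₂ (_ , v<n))     → <⇒≱ v<n n≤v
  }

mainTheorem2 : (m n : ℕ) → 2 ≤ m → 2 ≤ n → IsPathCriticalRamsey (Star n) (K m) n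
mainTheorem2 (suc M) n (s≤s (s≤s _)) (s≤s _) = r , (arrow-K , minimal) , (n≤r , arrow-KminusP) , maximal
  where
  r : ℕ
  r = suc (M * n)
  arrow-KminusP : Arrows (KminusP r n) (Star n) (K (suc M))
  arrow-KminusP = universal⇒arrows M KminusP-universal ≤-refl
  arrow-K : Arrows (K r) (Star n) (K (suc M))
  arrow-K = Arrows-mono {G = Star n} {H = K (suc M)} KminusP⊆K arrow-KminusP
  minimal : ∀ s → Arrows (K s) (Star n) (K (suc M)) → r ≤ s
  minimal s arrow = ≮⇒≥ λ s<r → K-non-arrow n M s (s≤s⁻¹ s<r) arrow
  n≤r : n ≤ r
  n≤r = ℕ.m≤n⇒m≤1+n (ℕ.m≤n*m n M)
  maximal : ∀ k → k ≤ r → Arrows (KminusP r k) (Star n) (K (suc M)) → k ≤ n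
  maximal k _ arrow = ≮⇒≥ λ n<k →
    KminusP-non-arrow n M (Arrows-mono {G = Star n} {H = K (suc M)} (KminusP-antitone n<k) arrow)
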